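{- Let $\vec p=p_0,\dots,p_{m-1}$ be a list of propositional variables, let $0\le i<m$, write $\vec p^{\setminus i}$ for the list $p_0,\dots,p_{i-1},p_{i+1},\dots,p_{m-1}$, and let $k\ge0$. There are $\mathsf{posELNDT}$ proofs over the extension axioms $\mathcal T$, of size polynomial in the size of the respective sequent, of $p_i,\ t^{\vec p^{\setminus i}}_k\to t^{\vec p}_{k+1}$ and of $t^{\vec p}_k\to p_i,\ t^{\vec p^{\setminus i}}_k$.
   Context: eNDT formulas: built from propositional variables, constants $0,1$ and extension variables by $\vee$ and decisions $\mathrm{dec}(A,p,B)$ ("if $p$ then $B$ else $A$", $p$ a propositional variable). $\mathrm{pd}(A,p,C):=\mathrm{dec}(A,p,A\vee C)$; positive formulas have only decisions of this form. An extension axiom $e\leftrightarrow A$ stands for sequents $e\to A$ and $A\to e$. Threshold axioms $\mathcal T$: for every list $\vec p$ of propositional variables and integer $k$, an extension variable $t^{\vec p}_k$, with axioms $t^{\epsilon}_0\leftrightarrow1$, $t^{\epsilon}_k\leftrightarrow0$ ($k\ne0$), $t^{p\vec p}_k\leftrightarrow\mathrm{pd}(t^{\vec p}_k,p,t^{\vec p}_{k-1})$ ($\epsilon$ empty list; $p\vec p$ = $\vec p$ with $p$ prepended). $\mathsf{posELNDT}$: sequents on multisets; initial sequents $0\to$, $\to1$, $p\to p$; cut; left/right weakening and contraction; $\vee$-left (from $\Gamma,A\to\Delta$ and $\Gamma,B\to\Delta$ infer $\Gamma,A\vee B\to\Delta$); $\vee$-right (from $\Gamma\to\Delta,A,B$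 infer $\Gamma\to\Delta,A\vee B$); positive decision left (from $\Gamma,A\to\Delta$ and $\Gamma,p,B\to\Delta$ infer $\Gamma,\mathrm{pd}(A,p,B)\to\Delta$) and right (from $\Gamma\to\Delta,A,p$ and $\Gamma\to\Delta,A,B$ infer $\Gamma\to\Delta,\mathrm{pd}(A,p,B)$); all formulas positive. A proof over a set of extension axioms: finite list of sequents, each an axiom sequent or derived by a rule (conclusion may contain extension variables). Size = number of symbols. -}

module Defs where

open import Data.Nat using (ℕ; zero; suc; _+_; _*_; _^_; _≤_)
open import Data.Integer as ℤ using (ℤ; +_; ∣_∣) renaming (_-_ to _-ℤ_; _+_ to _+ℤ_)
open import Data.Fin using (Fin)
open import Data.List using (List; []; _∷_; length; lookup; removeAt; map)
open import Data.Nat.ListAction using (sum)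
open import Data.List.Relation.Unary.All using (All)
open import Data.List.Relation.Unary.Any using (Any)
open import Data.List.Relation.Binary.Permutation.Propositional using (_↭_)
open import Data.Product using (_×_; _,_; Σ; ∃)
open import Relation.Binary.PropositionalEquality using (_≡_)
open import Relation.Nullary using (¬_)

PVar : Set
PVar = ℕ

record ExtVar : Set where
  constructor t[_,_]
  field
    vars  : List PVar
    index : ℤ

-- Positive eNDT formulas.  The only decisions are positive decisions
-- pd(A,p,C) = dec(A,p,A ∨ C); the constructor pd stands for that formula.
data Form : Set where
  var  : PVar → Form
  ⊥f   : Form
  ⊤f   : Form
  ext  : ExtVar → Form
  _∨f_ : Form → Form → Form
  pd   : Form → PVar → Form → Form

-- Number of symbols.  An extension variable t^{p_0..p_{m-1}}_k is written
-- with its list of variables and its index k (in unary).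
extSize : ExtVar → ℕ
extSize t[ ps , k ] = 1 + length ps + ∣ k ∣

size : Form → ℕ
size (var p)    = 1
size ⊥f         = 1
size ⊤f         = 1
size (ext e)    = extSize e
size (A ∨f B)   = 1 + size A + size B
-- dec(A,p,A ∨ C): symbol dec, A, p, and A ∨ C
size (pd A p C) = 1 + size A + 1 + (1 + size A + size C)

-- Sequents Γ → Δ (cedents are multisets, represented by lists up to permutation).
record Seq : Set where
  constructor _⇒_
  field
    ante : List Form
    succ : List Form

infix 4 _⇒_

seqSize : Seq → ℕ
seqSize (Γ ⇒ Δ) = 1 + sum (map size Γ) + length Γ + sum (map size Δ) + length Δ

_≈S_ : Seq → Seq → Set
(Γ ⇒ Δ) ≈S (Γ' ⇒ Δ') = (Γ ↭ Γ') × (Δ ↭ Δ')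

data Rule : List Seq → Seq → Set where
  ax0  : Rule [] (⊥f ∷ [] ⇒ [])
  ax1  : Rule [] ([] ⇒ ⊤f ∷ [])
  axp  : ∀ p → Rule [] (var p ∷ [] ⇒ var p ∷ [])
  cut  : ∀ {Γ Δ} A → Rule ((Γ ⇒ A ∷ Δ) ∷ (A ∷ Γ ⇒ Δ) ∷ []) (Γ ⇒ Δ)
  wkL  : ∀ {Γ Δ} A → Rule ((Γ ⇒ Δ) ∷ []) (A ∷ Γ ⇒ Δ)
  wkR  : ∀ {Γ Δ} A → Rule ((Γ ⇒ Δ) ∷ []) (Γ ⇒ A ∷ Δ)
  ctrL : ∀ {Γ Δ} A → Rule ((A ∷ A ∷ Γ ⇒ Δ) ∷ []) (A ∷ Γ ⇒ Δ)
  ctrR : ∀ {Γ Δ} A → Rule ((Γ ⇒ A ∷ A ∷ Δ) ∷ []) (Γ ⇒ A ∷ Δ)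
  ∨L   : ∀ {Γ Δ} A B → Rule ((A ∷ Γ ⇒ Δ) ∷ (B ∷ Γ ⇒ Δ) ∷ []) (A ∨f B ∷ Γ ⇒ Δ)
  ∨R   : ∀ {Γ Δ} A B → Rule ((Γ ⇒ A ∷ B ∷ Δ) ∷ []) (Γ ⇒ A ∨f B ∷ Δ)
  pdL  : ∀ {Γ Δ} A p B →
         Rule ((A ∷ Γ ⇒ Δ) ∷ (var p ∷ B ∷ Γ ⇒ Δ) ∷ []) (pd A p B ∷ Γ ⇒ Δ)
  pdR  : ∀ {Γ Δ} A p B →
         Rule ((Γ ⇒ A ∷ var p ∷ Δ) ∷ (Γ ⇒ A ∷ B ∷ Δ) ∷ []) (Γ ⇒ pd A p B ∷ Δ)

-- The threshold extension axioms 𝒯 (each e ↔ A gives e → A and A → e).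
data ThrDef : ExtVar → Form → Set where
  tε0 : ThrDef t[ [] , + 0 ] ⊤f
  tεk : ∀ k → ¬ (k ≡ + 0) → ThrDef t[ [] , k ] ⊥f
  tcons : ∀ p ps k →
          ThrDef t[ p ∷ ps , k ] (pd (ext t[ ps , k ]) p (ext t[ ps , k -ℤ + 1 ]))

data 𝒯 : Seq → Set where
  ext→ : ∀ {e A} → ThrDef e A → 𝒯 (ext e ∷ [] ⇒ A ∷ [])
  →ext : ∀ {e A} → ThrDef e A → 𝒯 (A ∷ [] ⇒ ext e ∷ [])

data Justified (Ax : Seq → Set) (prev : List Seq) (S : Seq) : Set where
  byAxiom : ∀ {S'} → Ax S' → S' ≈S S → Justified Ax prev S
  byRule  : ∀ {ps c} → Rule ps c → All (λ P → Any (P ≈S_) prev) ps → c ≈S S →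
            Justified Ax prev S

-- A proof is a list of sequents, stored with the LAST line first.
data IsProof (Ax : Seq → Set) : List Seq → Set where
  []  : IsProof Ax []
  _∷_ : ∀ {S prev} → Justified Ax prev S → IsProof Ax prev → IsProof Ax (S ∷ prev)

proofSize : List Seq → ℕ
proofSize π = sum (map seqSize π)

data ProofOf (Ax : Seq → Set) (S : Seq) : List Seq → Set where
  proofOf : ∀ {prev} → IsProof Ax (S ∷ prev) → ProofOf Ax S (S ∷ prev)

t : List PVar → ℕ → Form
t ps k = ext t[ ps , + k ]

seqA : (ps : List PVar) → Fin (length ps) → ℕ → Seq
seqA ps i k = var (lookup ps i) ∷ t (removeAt ps i) k ∷ [] ⇒ t ps (suc k) ∷ []

seqB : (ps : List PVar) → Fin (length ps) → ℕ → Seq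
seqB ps i k = t ps k ∷ [] ⇒ var (lookup ps i) ∷ t (removeAt ps i) k ∷ []

-- Write p⃗ = q q⃗.  For i = 0 both sequents follow from the axiom
-- t^{q q⃗}_n ↔ pd(t^{q⃗}_n, q, t^{q⃗}_{n-1}) and identities.  For i = j+1 let r⃗ be
-- q⃗ without p_j, so that p⃗^{∖i} = q r⃗; unfolding t^{q r⃗}_n and t^{q q⃗} by the
-- pd rules reduces the claim for (q q⃗, j+1, n) to the claims for (q⃗, j, n) and
-- (q⃗, j, n-1), where for n = 0 a weakening of ⊢ t_0 takes the place of the
-- latter.  Proving all n ≤ k level by level and sharing lines gives O(|p⃗|·k)
-- lines, each with at most six formulas of size O(|p⃗| + k): the size is cubic.
module Submission where

open import Defs
open import Data.Bool using (T)
open import Data.Fin as Fin using (Fin)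
open import Data.Integer using (+_; -[1+_]; ∣_∣) renaming (_-_ to _-ℤ_)
open import Data.Integer.Properties using (∣i-j∣≤∣i∣+∣j∣)
open import Data.List using (List; []; _∷_; _++_; length; lookup; removeAt; map)
open import Data.List.Properties using (length-removeAt′; length-++-≤ˡ)
open import Data.List.Relation.Binary.Permutation.Propositional
  using (_↭_; ↭-refl; ↭-trans; prep; swap)
open import Data.List.Relation.Binary.Permutation.Propositional.Properties
  using (All-resp-↭; ↭-length; ∷↭∷ʳ)
open import Data.List.Relation.Unary.All as All using (All; []; _∷_)
open import Data.List.Relation.Unary.Any as Any using (Any; here; there)
open import Data.Nat using (ℕ; zero; suc; _+_; _*_; _^_; _≤_; _<_; _≤ᵇ_; z≤n; s≤s)
open import Data.Nat.ListAction using (sum)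
open import Data.Nat.Properties
open import Data.Nat.Solver using (module +-*-Solver)
open import Data.Product using (Σ; _×_; _,_)
open import Data.Sum using (_⊎_; inj₁; inj₂)
open import Data.Unit using (tt)
open import Relation.Binary.PropositionalEquality as ≡ using (_≡_; refl; sym; cong)

auto≤ : ∀ {m n} → {{T (m ≤ᵇ n)}} → m ≤ n
auto≤ {m} {n} {{m≤ᵇn}} = ≤ᵇ⇒≤ m n m≤ᵇn

length-removeAt≤ : ∀ {A : Set} (xs : List A) i → length (removeAt xs i) ≤ length xs
length-removeAt≤ xs i = ≤-trans (n≤1+n _) (≤-reflexive (sym (length-removeAt′ xs i)))

∣K-1∣≤1+∣K∣ : ∀ K → ∣ K -ℤ + 1 ∣ ≤ suc ∣ K ∣
∣K-1∣≤1+∣K∣ K = ≤-trans (∣i-j∣≤∣i∣+∣j∣ K (+ 1)) (≤-reflexive (+-comm ∣ K ∣ 1))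

≈S-refl : ∀ {S} → S ≈S S
≈S-refl = ↭-refl , ↭-refl

≈S-trans : ∀ {S₁ S₂ S₃} → S₁ ≈S S₂ → S₂ ≈S S₃ → S₁ ≈S S₃
≈S-trans (Γ₁₂ , Δ₁₂) (Γ₂₃ , Δ₂₃) = ↭-trans Γ₁₂ Γ₂₃ , ↭-trans Δ₁₂ Δ₂₃

swap-front : ∀ {A : Set} {x y : A} {xs} → x ∷ y ∷ xs ↭ y ∷ x ∷ xs
swap-front = swap _ _ ↭-refl

definiens : ExtVar → Form
definiens t[ [] , + zero ] = ⊤f
definiens t[ [] , + suc n ] = ⊥f
definiens t[ [] , -[1+ n ] ] = ⊥f
definiens t[ p ∷ ps , k ] = pd (ext t[ ps , k ]) p (ext t[ ps , k -ℤ + 1 ])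

definiens-axiom : ∀ e → ThrDef e (definiens e)
definiens-axiom t[ [] , + zero ] = tε0
definiens-axiom t[ [] , + suc n ] = tεk (+ suc n) (λ ())
definiens-axiom t[ [] , -[1+ n ] ] = tεk -[1+ n ] (λ ())
definiens-axiom t[ p ∷ ps , k ] = tcons p ps k

module Construction (E : ℕ) where

  F : ℕ
  F = 3 + 3 * E

  record BoundedExt (e : ExtVar) : Set where
    constructor boundedExt
    field extSize≤ : extSize e ≤ E

  record Bounded (A : Form) : Set where
    constructor bounded
    field size≤ : size A ≤ F

  BoundedExt-tail : ∀ {q qs K} → BoundedExt t[ q ∷ qs , K ] → BoundedExt t[ qs , K ]
  BoundedExt-tail (boundedExt h) = boundedExt (≤-trans (n≤1+n _) h)

  BoundedExt-tail-pred : ∀ {q qs K} → BoundedExt t[ q ∷ qs , K ] → BoundedExt t[ qs , K -ℤ + 1 ]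
  BoundedExt-tail-pred {qs = qs} {K} (boundedExt h) =
    boundedExt (≤-trans (s≤s (+-monoʳ-≤ (length qs) (∣K-1∣≤1+∣K∣ K)))
                        (≤-trans (≤-reflexive (cong suc (+-suc (length qs) ∣ K ∣))) h))

  BoundedExt-mono : ∀ {xs ys a b} → length xs ≤ length ys → ∣ a ∣ ≤ ∣ b ∣ →
                    BoundedExt t[ ys , b ] → BoundedExt t[ xs , a ]
  BoundedExt-mono xs≤ys a≤b (boundedExt h) = boundedExt (≤-trans (s≤s (+-mono-≤ xs≤ys a≤b)) h)

  E≤F : E ≤ F
  E≤F = ≤-trans (m≤m+n E _) (m≤n+m _ 3)

  instance
    bounded-var : ∀ {p} → Bounded (var p)
    bounded-var = bounded (s≤s z≤n)

    bounded-⊤ : Bounded ⊤f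
    bounded-⊤ = bounded (s≤s z≤n)

    bounded-⊥ : Bounded ⊥f
    bounded-⊥ = bounded (s≤s z≤n)

    bounded-ext : ∀ {e} → {{BoundedExt e}} → Bounded (ext e)
    bounded-ext {{boundedExt h}} = bounded (≤-trans h E≤F)

    bounded-pd : ∀ {e₀ p e₁} → {{BoundedExt e₀}} → {{BoundedExt e₁}} → Bounded (pd (ext e₀) p (ext e₁))
    bounded-pd {e₀} {_} {e₁} {{boundedExt h₀}} {{boundedExt h₁}} =
      bounded (≤-trans (≤-reflexive (size-pd (extSize e₀) (extSize e₁)))
                       (+-monoʳ-≤ 3 (+-mono-≤ h₀ (+-mono-≤ h₀ (+-monoˡ-≤ 0 h₁)))))
      where
      open +-*-Solver
      size-pd : ∀ a b → 1 + a + 1 + (1 + a + b) ≡ 3 + (a + (a + (b + 0)))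
      size-pd = solve 2 (λ a b → con 1 :+ a :+ con 1 :+ (con 1 :+ a :+ b) := con 3 :+ (a :+ (a :+ (b :+ con 0)))) refl

    bounded-[] : All Bounded []
    bounded-[] = []

    bounded-∷ : ∀ {A Γ} → {{Bounded A}} → {{All Bounded Γ}} → All Bounded (A ∷ Γ)
    bounded-∷ {{b}} {{bs}} = b ∷ bs

  bounded-definiens : ∀ e → BoundedExt e → Bounded (definiens e)
  bounded-definiens t[ [] , + zero ] _ = bounded-⊤
  bounded-definiens t[ [] , + suc n ] _ = bounded-⊥
  bounded-definiens t[ [] , -[1+ n ] ] _ = bounded-⊥
  bounded-definiens t[ p ∷ ps , k ] b = bounded-pd {{BoundedExt-tail b}} {{BoundedExt-tail-pred b}}

  record Small (S : Seq) : Set where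
    constructor small
    field
      ante-bounded : All Bounded (Seq.ante S)
      succ-bounded : All Bounded (Seq.succ S)
      ante-short : length (Seq.ante S) ≤ 6
      succ-short : length (Seq.succ S) ≤ 6

  instance
    small-auto : ∀ {Γ Δ} → {{All Bounded Γ}} → {{All Bounded Δ}} →
                 {{T (length Γ ≤ᵇ 6)}} → {{T (length Δ ≤ᵇ 6)}} → Small (Γ ⇒ Δ)
    small-auto {{bΓ}} {{bΔ}} = small bΓ bΔ auto≤ auto≤

  small-resp : ∀ {S S'} → S ≈S S' → Small S → Small S'
  small-resp (Γ↭ , Δ↭) (small bΓ bΔ lΓ lΔ) =
    small (All-resp-↭ Γ↭ bΓ) (All-resp-↭ Δ↭ bΔ)
          (≤-trans (≤-reflexive (sym (↭-length Γ↭))) lΓ) (≤-trans (≤-reflexive (sym (↭-length Δ↭))) lΔ)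

  small-dropᴬ : ∀ {A Γ Δ} → Small (A ∷ Γ ⇒ Δ) → Small (Γ ⇒ Δ)
  small-dropᴬ (small (_ ∷ bΓ) bΔ lΓ lΔ) = small bΓ bΔ (≤-trans (n≤1+n _) lΓ) lΔ

  small-dropˢ : ∀ {A Γ Δ} → Small (Γ ⇒ A ∷ Δ) → Small (Γ ⇒ Δ)
  small-dropˢ (small bΓ (_ ∷ bΔ) lΓ lΔ) = small bΓ bΔ lΓ (≤-trans (n≤1+n _) lΔ)

  small-heads : ∀ {A Γ B Δ} → Small (A ∷ Γ ⇒ B ∷ Δ) → Small (A ∷ [] ⇒ B ∷ [])
  small-heads (small (bA ∷ _) (bB ∷ _) _ _) = small (bA ∷ []) (bB ∷ []) auto≤ auto≤

  lineSize : ℕ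
  lineSize = 1 + 6 * F + 6 + 6 * F + 6

  cedentSize≤ : ∀ Γ → All Bounded Γ → sum (map size Γ) ≤ length Γ * F
  cedentSize≤ [] [] = z≤n
  cedentSize≤ (A ∷ Γ) (bounded h ∷ bΓ) = +-mono-≤ h (cedentSize≤ Γ bΓ)

  seqSize≤lineSize : ∀ S → Small S → seqSize S ≤ lineSize
  seqSize≤lineSize (Γ ⇒ Δ) (small bΓ bΔ lΓ lΔ) =
    +-mono-≤ (+-mono-≤ (+-mono-≤ (+-monoʳ-≤ 1 (≤-trans (cedentSize≤ Γ bΓ) (*-monoˡ-≤ F lΓ))) lΓ)
                       (≤-trans (cedentSize≤ Δ bΔ) (*-monoˡ-≤ F lΔ)))
             lΔ

  proofSize≤ : ∀ π → All Small π → proofSize π ≤ length π * lineSize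
  proofSize≤ [] [] = z≤n
  proofSize≤ (S ∷ π) (sS ∷ sπ) = +-mono-≤ (seqSize≤lineSize S sS) (proofSize≤ π sπ)

  record ProofState : Set where
    constructor state
    field
      lines : List Seq
      valid : IsProof 𝒯 lines
      all-small : All Small lines
  open ProofState

  record _∈_ (S : Seq) (s : ProofState) : Set where
    constructor occurs
    field occurrence : Any (S ≈S_) (lines s)

  _⊑_ : ProofState → ProofState → Set
  s ⊑ s' = ∀ {S} → S ∈ s → S ∈ s'

  ∈-resp-≈S : ∀ {s S S'} → S' ≈S S → S ∈ s → S' ∈ s
  ∈-resp-≈S S'≈S (occurs h) = occurs (Any.map (≈S-trans S'≈S) h)

  swapᴬ : ∀ {s A B Γ Δ} → (A ∷ B ∷ Γ ⇒ Δ) ∈ s → (B ∷ A ∷ Γ ⇒ Δ) ∈ s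
  swapᴬ = ∈-resp-≈S (swap-front , ↭-refl)

  swapˢ : ∀ {s Γ A B Δ} → (Γ ⇒ A ∷ B ∷ Δ) ∈ s → (Γ ⇒ B ∷ A ∷ Δ) ∈ s
  swapˢ = ∈-resp-≈S (↭-refl , swap-front)

  record Extension (s : ProofState) (P : ProofState → Set) (c : ℕ) : Set where
    constructor extension
    field
      extended : ProofState
      grows : s ⊑ extended
      derives : P extended
      cost : length (lines extended) ≤ c + length (lines s)

  done : ∀ {s P} → P s → Extension s P 0
  done p = extension _ (λ h → h) p ≤-refl

  relax : ∀ {s P c c'} → c ≤ c' → Extension s P c → Extension s P c'
  relax c≤c' (extension s' grows p cost) = extension s' grows p (≤-trans cost (+-monoˡ-≤ _ c≤c'))

  _>>=_ : ∀ {s P Q c₁ c₂} → Extension s P c₁ → (∀ s₁ → s ⊑ s₁ → P s₁ → Extension s₁ Q c₂) →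
          Extension s Q (c₁ + c₂)
  _>>=_ {s} {c₁ = c₁} {c₂} (extension s₁ ↑₁ p cost₁) k with k s₁ ↑₁ p
  ... | extension s₂ ↑₂ q cost₂ = extension s₂ (λ h → ↑₂ (↑₁ h)) q (begin
    length (lines s₂)            ≤⟨ cost₂ ⟩
    c₂ + length (lines s₁)       ≤⟨ +-monoʳ-≤ c₂ cost₁ ⟩
    c₂ + (c₁ + length (lines s)) ≡⟨ sym (+-assoc c₂ c₁ _) ⟩
    c₂ + c₁ + length (lines s)   ≡⟨ cong (_+ length (lines s)) (+-comm c₂ c₁) ⟩
    c₁ + c₂ + length (lines s)   ∎)
    where open ≤-Reasoning

  permute : ∀ {s S S' c} → S' ≈S S → Extension s (S ∈_) c → Extension s (S' ∈_) c
  permute S'≈S (extension s' grows h cost) = extension s' grows (∈-resp-≈S S'≈S h) cost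

  addLine : ∀ s {S} → Justified 𝒯 (lines s) S → Small S → Extension s (S ∈_) 1
  addLine (state π valid sm) j sS =
    extension (state (_ ∷ π) (j ∷ valid) (sS ∷ sm)) (λ (occurs h) → occurs (there h)) (occurs (here ≈S-refl)) ≤-refl

  infer : ∀ {s ps S} → Rule ps S → All (_∈ s) ps → {{Small S}} → Extension s (S ∈_) 1
  infer {s} r premises {{sS}} = addLine s (byRule r (All.map _∈_.occurrence premises) ≈S-refl) sS

  axiom : ∀ {s S} → 𝒯 S → {{Small S}} → Extension s (S ∈_) 1
  axiom {s} ax {{sS}} = addLine s (byAxiom ax ≈S-refl) sS

  small-dropsˢ : ∀ {Γ Δ₀} Δ → Small (Γ ⇒ Δ ++ Δ₀) → Small (Γ ⇒ Δ₀)
  small-dropsˢ [] sm = sm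
  small-dropsˢ (A ∷ Δ) sm = small-dropsˢ Δ (small-dropˢ sm)

  weakenᴬ : ∀ {s Γ₀ Δ} Γ → Small (Γ ++ Γ₀ ⇒ Δ) → (Γ₀ ⇒ Δ) ∈ s → Extension s ((Γ ++ Γ₀ ⇒ Δ) ∈_) (length Γ)
  weakenᴬ [] _ h = done h
  weakenᴬ (A ∷ Γ) sm h = relax (≤-reflexive (+-comm (length Γ) 1))
    (weakenᴬ Γ (small-dropᴬ sm) h >>= λ _ _ h₁ → infer (wkL A) (h₁ ∷ []) {{sm}})

  weakenˢ : ∀ {s Γ Δ₀} Δ → Small (Γ ⇒ Δ ++ Δ₀) → (Γ ⇒ Δ₀) ∈ s → Extension s ((Γ ⇒ Δ ++ Δ₀) ∈_) (length Δ)
  weakenˢ [] _ h = done h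
  weakenˢ (A ∷ Δ) sm h = relax (≤-reflexive (+-comm (length Δ) 1))
    (weakenˢ Δ (small-dropˢ sm) h >>= λ _ _ h₁ → infer (wkR A) (h₁ ∷ []) {{sm}})

  weaken : ∀ {s Γ₀ Δ₀} Γ Δ → {{Small (Γ ++ Γ₀ ⇒ Δ ++ Δ₀)}} → (Γ₀ ⇒ Δ₀) ∈ s →
           Extension s ((Γ ++ Γ₀ ⇒ Δ ++ Δ₀) ∈_) 12
  weaken Γ Δ {{sm}} h = relax (+-mono-≤ (≤-trans (length-++-≤ˡ Γ) (Small.ante-short sm))
                                        (≤-trans (length-++-≤ˡ Δ) (Small.succ-short sm)))
    (weakenᴬ Γ (small-dropsˢ Δ sm) h >>= λ _ _ h₁ → weakenˢ Δ sm h₁)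

  cutRight : ∀ {s Γ Δ A B} → {{Small (A ∷ Γ ⇒ B ∷ A ∷ Δ)}} →
             (Γ ⇒ A ∷ Δ) ∈ s → (A ∷ [] ⇒ B ∷ []) ∈ s → Extension s ((Γ ⇒ B ∷ Δ) ∈_) 25
  cutRight {Γ = Γ} {Δ} {A} {B} {{sm}} ΓA AB =
    weaken [] (B ∷ []) {{small-dropᴬ sm}} ΓA >>= λ _ ↑₁ ΓBA →
    weaken Γ Δ {{small-resp moveA sAΓB}} (↑₁ AB) >>= λ _ ↑₂ AΓB →
    infer (cut A) (swapˢ (↑₂ ΓBA) ∷ ∈-resp-≈S moveA AΓB ∷ []) {{small-dropᴬ sAΓB}}
    where
    moveA : (A ∷ Γ ⇒ B ∷ Δ) ≈S (Γ ++ A ∷ [] ⇒ Δ ++ B ∷ [])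
    moveA = ∷↭∷ʳ A Γ , ∷↭∷ʳ B Δ
    sAΓB : Small (A ∷ Γ ⇒ B ∷ Δ)
    sAΓB = small-dropˢ (small-resp (↭-refl , swap-front) sm)

  cutLeft : ∀ {s Γ Δ A B} → {{Small (B ∷ A ∷ Γ ⇒ A ∷ Δ)}} →
            (A ∷ Γ ⇒ Δ) ∈ s → (B ∷ [] ⇒ A ∷ []) ∈ s → Extension s ((B ∷ Γ ⇒ Δ) ∈_) 25
  cutLeft {Γ = Γ} {Δ} {A} {B} {{sm}} AΓ BA =
    weaken (B ∷ []) [] {{small-dropˢ sm}} AΓ >>= λ _ ↑₁ BAΓ →
    weaken Γ Δ {{small-resp moveB sBΓA}} (↑₁ BA) >>= λ _ ↑₂ BΓA →
    infer (cut A) (∈-resp-≈S moveB BΓA ∷ swapᴬ (↑₂ BAΓ) ∷ []) {{small-dropˢ sBΓA}}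
    where
    moveB : (B ∷ Γ ⇒ A ∷ Δ) ≈S (Γ ++ B ∷ [] ⇒ Δ ++ A ∷ [])
    moveB = ∷↭∷ʳ B Γ , ∷↭∷ʳ A Δ
    sBΓA : Small (B ∷ Γ ⇒ A ∷ Δ)
    sBΓA = small-dropᴬ (small-resp (swap-front , ↭-refl) sm)

  threshold-right : ∀ {s Γ Δ q qs K} →
    let T₀ = ext t[ qs , K ]; T₁ = ext t[ qs , K -ℤ + 1 ]; H = pd T₀ q T₁; G = ext t[ q ∷ qs , K ] in
    {{Small (H ∷ Γ ⇒ G ∷ H ∷ Δ)}} →
    (Γ ⇒ T₀ ∷ var q ∷ Δ) ∈ s → (Γ ⇒ T₀ ∷ T₁ ∷ Δ) ∈ s → Extension s ((Γ ⇒ G ∷ Δ) ∈_) 27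
  threshold-right {q = q} {qs} {K} {{sm}} ΓT₀q ΓT₀T₁ =
    infer (pdR _ q _) (ΓT₀q ∷ ΓT₀T₁ ∷ []) {{small-dropᴬ (small-dropˢ sm)}} >>= λ _ _ ΓH →
    axiom (→ext (tcons q qs K)) {{small-heads sm}} >>= λ _ ↑₂ HG →
    cutRight {{sm}} (↑₂ ΓH) HG

  threshold-left : ∀ {s Γ Δ q qs K} →
    let D = pd (ext t[ qs , K ]) q (ext t[ qs , K -ℤ + 1 ]); G = ext t[ q ∷ qs , K ] in
    {{Small (G ∷ D ∷ Γ ⇒ D ∷ Δ)}} → (D ∷ Γ ⇒ Δ) ∈ s → Extension s ((G ∷ Γ ⇒ Δ) ∈_) 26
  threshold-left {q = q} {qs} {K} {{sm}} DΓ =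
    axiom (ext→ (tcons q qs K)) {{small-heads sm}} >>= λ _ ↑₁ GD →
    cutLeft {{sm}} (↑₁ DΓ) GD

  threshold-right-tail : ∀ {s Γ Δ q qs K} →
    let T₀ = ext t[ qs , K ]; T₁ = ext t[ qs , K -ℤ + 1 ]; H = pd T₀ q T₁; G = ext t[ q ∷ qs , K ] in
    {{Small (Γ ⇒ var q ∷ T₀ ∷ Δ)}} → {{Small (Γ ⇒ T₁ ∷ T₀ ∷ Δ)}} → {{Small (H ∷ Γ ⇒ G ∷ H ∷ Δ)}} →
    (Γ ⇒ T₀ ∷ Δ) ∈ s → Extension s ((Γ ⇒ G ∷ Δ) ∈_) 51
  threshold-right-tail {q = q} {qs} {K} {{sq}} {{sT₁}} {{sH}} ΓT₀ =
    weaken [] (var q ∷ []) {{sq}} ΓT₀ >>= λ _ ↑₁ ΓqT₀ →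
    weaken [] (ext t[ qs , K -ℤ + 1 ] ∷ []) {{sT₁}} (↑₁ ΓT₀) >>= λ _ ↑₂ ΓT₁T₀ →
    threshold-right {{sH}} (swapˢ (↑₂ ΓqT₀)) (swapˢ ΓT₁T₀)

  threshold-right-step : ∀ {s Γ Δ q qs K} →
    let T₀ = ext t[ qs , K ]; T₁ = ext t[ qs , K -ℤ + 1 ]; H = pd T₀ q T₁; G = ext t[ q ∷ qs , K ] in
    {{Small (var q ∷ Γ ⇒ T₀ ∷ var q ∷ Δ)}} → {{Small (var q ∷ Γ ⇒ T₀ ∷ T₁ ∷ Δ)}} →
    {{Small (H ∷ var q ∷ Γ ⇒ G ∷ H ∷ Δ)}} →
    (Γ ⇒ T₁ ∷ Δ) ∈ s → Extension s ((var q ∷ Γ ⇒ G ∷ Δ) ∈_) 52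
  threshold-right-step {Γ = Γ} {Δ} {q} {qs} {K} {{sq}} {{sT₁}} {{sH}} ΓT₁ =
    infer (axp q) [] >>= λ _ ↑₁ qq →
    weaken Γ (T₀ ∷ Δ) {{small-resp moveq sq}} qq >>= λ _ ↑₂ ΓqT₀q →
    weaken (var q ∷ []) (T₀ ∷ []) {{sT₁}} (↑₂ (↑₁ ΓT₁)) >>= λ _ ↑₃ qΓT₀T₁ →
    threshold-right {{sH}} (∈-resp-≈S moveq (↑₃ ΓqT₀q)) qΓT₀T₁
    where
    T₀ = ext t[ qs , K ]
    moveq : (var q ∷ Γ ⇒ T₀ ∷ var q ∷ Δ) ≈S (Γ ++ var q ∷ [] ⇒ T₀ ∷ Δ ++ var q ∷ [])
    moveq = ∷↭∷ʳ (var q) Γ , prep T₀ (∷↭∷ʳ (var q) Δ)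

  ext-identity : ∀ {s} e → {{BoundedExt e}} → Extension s ((ext e ∷ [] ⇒ ext e ∷ []) ∈_) 27
  ext-identity e {{b}} =
    axiom (ext→ (definiens-axiom e)) >>= λ _ _ unfold →
    axiom (→ext (definiens-axiom e)) >>= λ _ ↑₂ fold →
    cutRight (↑₂ unfold) fold
    where instance _ = bounded-definiens e b

  threshold-zero : ∀ {s} xs → {{BoundedExt t[ xs , + 0 ]}} →
                   Extension s (([] ⇒ t xs 0 ∷ []) ∈_) (suc (length xs) * 51)
  threshold-zero [] = relax auto≤
    (infer ax1 [] >>= λ _ _ ⊢⊤ →
     axiom (→ext tε0) >>= λ _ ↑₂ ⊤⊢t →
     cutRight (↑₂ ⊢⊤) ⊤⊢t)
  threshold-zero (q ∷ qs) {{b}} = relax (≤-reflexive (+-comm (suc (length qs) * 51) 51))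
    (threshold-zero qs >>= λ _ _ ⊢T₀ → threshold-right-tail ⊢T₀)
    where instance
      _ = BoundedExt-tail b
      _ = BoundedExt-tail-pred b

  seqA-head : ∀ {s} q qs n → {{BoundedExt t[ q ∷ qs , + suc n ]}} →
              Extension s (seqA (q ∷ qs) Fin.zero n ∈_) 79
  seqA-head q qs n {{b}} =
    ext-identity t[ qs , + n ] >>= λ _ _ T₁T₁ →
    threshold-right-step T₁T₁
    where instance
      _ = BoundedExt-tail b
      _ = BoundedExt-tail-pred b

  seqA-step : ∀ {s} q p qs r n → {{BoundedExt t[ q ∷ qs , + suc n ]}} → {{BoundedExt t[ q ∷ r , + n ]}} →
    (var p ∷ t r n ∷ [] ⇒ t qs (suc n) ∷ []) ∈ s →
    (var p ∷ ext t[ r , + n -ℤ + 1 ] ∷ [] ⇒ t qs n ∷ []) ∈ s →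
    Extension s ((var p ∷ t (q ∷ r) n ∷ [] ⇒ t (q ∷ qs) (suc n) ∷ []) ∈_) 130
  seqA-step q p qs r n {{bqs}} {{br}} ih ih₋ =
    threshold-right-tail ih >>= λ _ ↑₁ pR₀G →
    threshold-right-step (↑₁ ih₋) >>= λ _ ↑₂ qpR₁G →
    infer (pdL _ q _) (swapᴬ (↑₂ pR₀G) ∷ ∈-resp-≈S (prep (var q) swap-front , ↭-refl) qpR₁G ∷ []) >>= λ _ _ DpG →
    permute (swap-front , ↭-refl) (threshold-left DpG)
    where instance
      _ = BoundedExt-tail bqs
      _ = BoundedExt-tail-pred bqs
      _ = BoundedExt-tail br
      _ = BoundedExt-tail-pred br

  seqB-head : ∀ {s} q qs n → {{BoundedExt t[ q ∷ qs , + n ]}} →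
              Extension s (seqB (q ∷ qs) Fin.zero n ∈_) 79
  seqB-head q qs n {{b}} =
    ext-identity t[ qs , + n ] >>= λ _ _ R₀R₀ →
    weaken [] (var q ∷ []) R₀R₀ >>= λ _ ↑₂ R₀qR₀ →
    infer (axp q) [] >>= λ _ ↑₃ qq →
    weaken (ext t[ qs , + n -ℤ + 1 ] ∷ []) (ext t[ qs , + n ] ∷ []) qq >>= λ _ ↑₄ R₁qR₀q →
    infer (pdL _ q _) (↑₄ (↑₃ R₀qR₀) ∷ ∈-resp-≈S (swap-front , swap-front) R₁qR₀q ∷ []) >>= λ _ _ DqR₀ →
    threshold-left DqR₀
    where instance
      _ = BoundedExt-tail b
      _ = BoundedExt-tail-pred b

  seqB-step : ∀ {s} q p qs r n → {{BoundedExt t[ q ∷ qs , + n ]}} → {{BoundedExt t[ q ∷ r , + n ]}} →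
    (t qs n ∷ [] ⇒ var p ∷ t r n ∷ []) ∈ s →
    (var q ∷ ext t[ qs , + n -ℤ + 1 ] ∷ [] ⇒ var p ∷ t (q ∷ r) n ∷ []) ∈ s →
    Extension s ((t (q ∷ qs) n ∷ [] ⇒ var p ∷ t (q ∷ r) n ∷ []) ∈_) 78
  seqB-step q p qs r n {{bqs}} {{br}} ih qR₁pG =
    threshold-right-tail (swapˢ ih) >>= λ _ ↑₁ R₀Gp →
    infer (pdL _ q _) (swapˢ R₀Gp ∷ ↑₁ qR₁pG ∷ []) >>= λ _ _ DpG →
    threshold-left DpG
    where instance
      _ = BoundedExt-tail bqs
      _ = BoundedExt-tail-pred bqs
      _ = BoundedExt-tail br
      _ = BoundedExt-tail-pred br

  seqB-step-premise : ∀ {s} q p qs r n → {{BoundedExt t[ q ∷ qs , + suc n ]}} → {{BoundedExt t[ q ∷ r , + suc n ]}} →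
    (t qs n ∷ [] ⇒ var p ∷ t r n ∷ []) ∈ s →
    Extension s ((var q ∷ t qs n ∷ [] ⇒ var p ∷ t (q ∷ r) (suc n) ∷ []) ∈_) 52
  seqB-step-premise q p qs r n {{bqs}} {{br}} ih =
    permute (↭-refl , swap-front) (threshold-right-step (swapˢ ih))
    where instance
      _ = BoundedExt-tail-pred bqs
      _ = BoundedExt-tail br
      _ = BoundedExt-tail-pred br

  DerivedUpTo : ℕ → (ℕ → Seq) → ProofState → Set
  DerivedUpTo k S s = ∀ {n} → n ≤ k → S n ∈ s

  upTo : ∀ {s c} (S : ℕ → Seq) k → (∀ {n} → n ≤ k → ∀ s' → s ⊑ s' → Extension s' (S n ∈_) c) →
         Extension s (DerivedUpTo k S) (suc k * c)
  upTo S zero each = each z≤n _ (λ h → h) >>= λ _ _ S₀ → done λ { z≤n → S₀ }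
  upTo {c = c} S (suc k) each =
    relax (≤-reflexive (≡.trans (cong (_+_ (suc k * c)) (+-identityʳ c)) (+-comm (suc k * c) c)))
      (upTo S k (λ n≤k → each (m≤n⇒m≤1+n n≤k)) >>= λ s₁ ↑₁ below →
       each ≤-refl s₁ ↑₁ >>= λ _ ↑₂ top →
       done (λ n≤1+k → extend ↑₂ below top (m≤n⇒m<n∨m≡n n≤1+k)))
    where
    extend : ∀ {s₁ s₂ n} → s₁ ⊑ s₂ → DerivedUpTo k S s₁ → S (suc k) ∈ s₂ → n < suc k ⊎ n ≡ suc k → S n ∈ s₂
    extend ↑ below _ (inj₁ (s≤s n≤k)) = ↑ (below n≤k)
    extend _ _ top (inj₂ refl) = top

  BoundedExt-below : ∀ {xs n k} → n ≤ k → BoundedExt t[ xs , + suc k ] → BoundedExt t[ xs , + suc n ]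
  BoundedExt-below n≤k = BoundedExt-mono ≤-refl (s≤s n≤k)

  -- One level: ⊢ t_0 (51 lines per variable) and at most 150 lines for each n ≤ k.
  levelCost : ℕ
  levelCost = 201 * E

  levelCost-bound : ∀ {q qs k} l → l ≤ suc (length qs) → BoundedExt t[ q ∷ qs , + suc k ] →
                    suc l * 51 + suc k * 150 ≤ levelCost
  levelCost-bound {qs = qs} {k} l l≤ (boundedExt h) = begin
    suc l * 51 + suc k * 150 ≤⟨ +-mono-≤ (*-monoˡ-≤ 51 1+l≤E) (*-monoˡ-≤ 150 1+k≤E) ⟩
    E * 51 + E * 150         ≡⟨ sym (*-distribˡ-+ E 51 150) ⟩
    E * 201                  ≡⟨ *-comm E 201 ⟩
    201 * E                  ∎
    where
    open ≤-Reasoning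
    1+l≤E : suc l ≤ E
    1+l≤E = ≤-trans (s≤s (≤-trans l≤ (s≤s (m≤m+n (length qs) (suc k))))) h
    1+k≤E : suc k ≤ E
    1+k≤E = ≤-trans (≤-trans (m≤n+m (suc k) (length qs)) (≤-trans (n≤1+n _) (n≤1+n _))) h

  headCost-bound : ∀ {q qs k} → BoundedExt t[ q ∷ qs , + suc k ] → suc k * 79 ≤ length (q ∷ qs) * levelCost
  headCost-bound {q} {qs} {k} b = begin
    suc k * 79                  ≤⟨ *-monoʳ-≤ (suc k) (auto≤ {79} {150}) ⟩
    suc k * 150                 ≤⟨ m≤n+m _ (1 * 51) ⟩
    1 * 51 + suc k * 150        ≤⟨ levelCost-bound 0 z≤n b ⟩
    levelCost                   ≤⟨ m≤m+n _ _ ⟩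
    length (q ∷ qs) * levelCost ∎
    where open ≤-Reasoning

  seqA-next : ∀ {s} q qs j n → {{BoundedExt t[ q ∷ qs , + suc n ]}} →
    DerivedUpTo n (seqA qs j) s → ([] ⇒ t qs 0 ∷ []) ∈ s → Extension s (seqA (q ∷ qs) (Fin.suc j) n ∈_) 150
  -- For n = 0 the second premise of seqA-step has the index -1 and is a weakening of ⊢ t^{q⃗}_0.
  seqA-next q qs j zero {{b}} ih ⊢T =
    relax auto≤ (weaken (var p ∷ ext t[ r , -[1+ 0 ] ] ∷ []) [] ⊢T >>= λ _ ↑ ih₋ → seqA-step q p qs r 0 (↑ (ih ≤-refl)) ih₋)
    where
    p = lookup qs j
    r = removeAt qs j
    br : BoundedExt t[ q ∷ r , + 0 ]
    br = BoundedExt-mono (s≤s (length-removeAt≤ qs j)) z≤n b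
    instance
      _ = br
      _ = BoundedExt-tail-pred b
      _ = BoundedExt-tail-pred br
  seqA-next q qs j (suc n) {{b}} ih _ =
    relax auto≤ (seqA-step q (lookup qs j) qs (removeAt qs j) (suc n) (ih ≤-refl) (ih (n≤1+n n)))
    where instance
      _ = BoundedExt-mono {xs = q ∷ removeAt qs j} {a = + suc n} (s≤s (length-removeAt≤ qs j)) (n≤1+n _) b

  seqA-upTo : ∀ {s} ps (i : Fin (length ps)) k → {{BoundedExt t[ ps , + suc k ]}} →
              Extension s (DerivedUpTo k (seqA ps i)) (length ps * levelCost)
  seqA-upTo (q ∷ qs) Fin.zero k {{b}} =
    relax (headCost-bound b)
      (upTo {c = 79} _ k λ n≤k _ _ → seqA-head q qs _ {{BoundedExt-below n≤k b}})
  seqA-upTo (q ∷ qs) (Fin.suc j) k {{b}} =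
    relax (≤-trans (+-monoʳ-≤ _ (levelCost-bound (length qs) (n≤1+n _) b)) (≤-reflexive (+-comm _ levelCost)))
      (seqA-upTo qs j k {{BoundedExt-tail b}} >>= λ _ ↑₁ below →
       threshold-zero qs {{BoundedExt-mono (n≤1+n _) z≤n b}} >>= λ _ ↑₂ ⊢T →
       upTo {c = 150} _ k λ n≤k _ ↑ →
         seqA-next q qs j _ {{BoundedExt-below n≤k b}} (λ m≤n → ↑ (↑₂ (below (≤-trans m≤n n≤k)))) (↑ ⊢T))

  seqB-next : ∀ {s} q qs j n → {{BoundedExt t[ q ∷ qs , + suc n ]}} →
    DerivedUpTo n (seqB qs j) s → ([] ⇒ t (q ∷ removeAt qs j) 0 ∷ []) ∈ s →
    Extension s (seqB (q ∷ qs) (Fin.suc j) n ∈_) 150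
  seqB-next q qs j zero {{b}} ih ⊢G =
    relax auto≤ (weaken (var q ∷ ext t[ qs , -[1+ 0 ] ] ∷ []) (var (lookup qs j) ∷ []) ⊢G >>= λ _ ↑ qR₁pG →
                 seqB-step q (lookup qs j) qs (removeAt qs j) 0 (↑ (ih ≤-refl)) qR₁pG)
    where
    bqs : BoundedExt t[ q ∷ qs , + 0 ]
    bqs = BoundedExt-mono ≤-refl z≤n b
    instance
      _ = bqs
      _ = BoundedExt-mono {xs = q ∷ removeAt qs j} {a = + 0} (s≤s (length-removeAt≤ qs j)) z≤n b
      _ = BoundedExt-tail-pred bqs
  seqB-next q qs j (suc n) {{b}} ih _ =
    relax auto≤ (seqB-step-premise q p qs r n (ih (n≤1+n n)) >>= λ _ ↑ qR₁pG →
                 seqB-step q p qs r (suc n) (↑ (ih ≤-refl)) qR₁pG)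
    where
    p = lookup qs j
    r = removeAt qs j
    instance
      _ = BoundedExt-mono {xs = q ∷ qs} {a = + suc n} ≤-refl (n≤1+n _) b
      _ = BoundedExt-mono {xs = q ∷ r} {a = + suc n} (s≤s (length-removeAt≤ qs j)) (n≤1+n _) b

  seqB-upTo : ∀ {s} ps (i : Fin (length ps)) k → {{BoundedExt t[ ps , + suc k ]}} →
              Extension s (DerivedUpTo k (seqB ps i)) (length ps * levelCost)
  seqB-upTo (q ∷ qs) Fin.zero k {{b}} =
    relax (headCost-bound b)
      (upTo {c = 79} _ k λ n≤k _ _ → seqB-head q qs _ {{BoundedExt-mono ≤-refl (m≤n⇒m≤1+n n≤k) b}})
  seqB-upTo (q ∷ qs) (Fin.suc j) k {{b}} =
    relax (≤-trans (+-monoʳ-≤ _ (levelCost-bound (suc (length (removeAt qs j))) (s≤s (length-removeAt≤ qs j)) b))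
                   (≤-reflexive (+-comm _ levelCost)))
      (seqB-upTo qs j k {{BoundedExt-tail b}} >>= λ _ ↑₁ below →
       threshold-zero (q ∷ removeAt qs j) {{BoundedExt-mono (s≤s (length-removeAt≤ qs j)) z≤n b}} >>= λ _ ↑₂ ⊢G →
       upTo {c = 150} _ k λ n≤k _ ↑ →
         seqB-next q qs j _ {{BoundedExt-below n≤k b}} (λ m≤n → ↑ (↑₂ (below (≤-trans m≤n n≤k)))) (↑ ⊢G))

  emptyState : ProofState
  emptyState = state [] [] []

  -- ProofOf needs the sequent itself as last line, whereas _∈_ only records it up
  -- to permutation; a weakening followed by a contraction re-derives it verbatim.
  conclude : ∀ {A Γ Δ c} → Extension emptyState ((A ∷ Γ ⇒ Δ) ∈_) c → {{Small (A ∷ A ∷ Γ ⇒ Δ)}} →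
             Σ (List Seq) λ π → ProofOf 𝒯 (A ∷ Γ ⇒ Δ) π × proofSize π ≤ (2 + c) * lineSize
  conclude {A} {c = c} derivation {{sm}} with (derivation >>= λ _ _ h → infer (wkL A) (h ∷ []) {{sm}})
  ... | extension s _ (occurs AAΓ) cost =
    _ , proofOf (byRule (ctrL A) (AAΓ ∷ []) ≈S-refl ∷ valid s) ,
    ≤-trans (proofSize≤ _ (small-dropᴬ sm ∷ all-small s))
            (*-monoˡ-≤ lineSize (s≤s (≤-trans cost (≤-reflexive (≡.trans (+-identityʳ _) (+-comm c 1))))))

  size-cubic : ∀ {l} → 1 ≤ E → l ≤ E * levelCost → (2 + l) * lineSize ≤ 17255 * E ^ 3
  size-cubic {l} 1≤E l≤ = begin
    (2 + l) * lineSize       ≤⟨ *-mono-≤ lines≤ lineSize≤ ⟩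
    203 * (E * E) * (85 * E) ≡⟨ solve 1 (λ e → con 203 :* (e :* e) :* (con 85 :* e) := con 17255 :* e :^ 3) refl E ⟩
    17255 * E ^ 3            ∎
    where
    open ≤-Reasoning
    open +-*-Solver
    lines≤ : 2 + l ≤ 203 * (E * E)
    lines≤ = begin
      2 + l                       ≤⟨ +-mono-≤ (*-monoʳ-≤ 2 (*-mono-≤ 1≤E 1≤E)) l≤ ⟩
      2 * (E * E) + E * (201 * E) ≡⟨ solve 1 (λ e → con 2 :* (e :* e) :+ e :* (con 201 :* e) := con 203 :* (e :* e)) refl E ⟩
      203 * (E * E)               ∎
    lineSize≤ : lineSize ≤ 85 * E
    lineSize≤ = begin
      lineSize        ≡⟨ solve 1 (λ e → con 1 :+ con 6 :* (con 3 :+ con 3 :* e) :+ con 6 :+ con 6 :* (con 3 :+ con 3 :* e) :+ con 6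
                                        := con 49 :+ con 36 :* e) refl E ⟩
      49 + 36 * E     ≤⟨ +-monoˡ-≤ (36 * E) (*-monoʳ-≤ 49 1≤E) ⟩
      49 * E + 36 * E ≡⟨ sym (*-distribʳ-+ E 49 36) ⟩
      85 * E          ∎

  cubic-proof : ∀ {A Γ Δ} l → suc l ≤ E → Extension emptyState ((A ∷ Γ ⇒ Δ) ∈_) (l * levelCost + 0) →
                {{Small (A ∷ A ∷ Γ ⇒ Δ)}} →
                Σ (List Seq) λ π → ProofOf 𝒯 (A ∷ Γ ⇒ Δ) π × proofSize π ≤ 17255 * E ^ 3
  cubic-proof l l<E derivation {{sm}} with conclude derivation {{sm}}
  ... | π , proof , size≤ = π , proof , ≤-trans size≤ (size-cubic (≤-trans (s≤s z≤n) l<E) lines≤)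
    where
    lines≤ : l * levelCost + 0 ≤ E * levelCost
    lines≤ = ≤-trans (≤-reflexive (+-identityʳ _)) (*-monoˡ-≤ levelCost (≤-trans (n≤1+n l) l<E))

seqA-proof : (ps : List PVar) (i : Fin (length ps)) (k : ℕ) →
  Σ (List Seq) λ π → ProofOf 𝒯 (seqA ps i k) π × proofSize π ≤ 17255 * seqSize (seqA ps i k) ^ 3
seqA-proof ps i k =
  cubic-proof (length ps) (≤-trans (s≤s (m≤m+n _ _)) bound)
    (seqA-upTo ps i k >>= λ _ _ upTo-k → done (upTo-k ≤-refl))
  where
  open Construction (seqSize (seqA ps i k))
  bound : extSize t[ ps , + suc k ] ≤ seqSize (seqA ps i k)
  bound = ≤-trans (m≤m+n _ 0) (≤-trans (m≤n+m _ (1 + sum (map size (var (lookup ps i) ∷ t (removeAt ps i) k ∷ [])) + 2))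
                                      (m≤m+n _ 1))
  instance
    bps : BoundedExt t[ ps , + suc k ]
    bps = boundedExt bound
    _ = BoundedExt-mono {xs = removeAt ps i} {a = + k} (length-removeAt≤ ps i) (n≤1+n k) bps

seqB-proof : (ps : List PVar) (i : Fin (length ps)) (k : ℕ) →
  Σ (List Seq) λ π → ProofOf 𝒯 (seqB ps i k) π × proofSize π ≤ 17255 * seqSize (seqB ps i k) ^ 3
seqB-proof ps i k =
  cubic-proof (length ps) (≤-trans (s≤s (m≤m+n _ _)) bound)
    (seqB-upTo ps i k >>= λ _ _ upTo-k → done (upTo-k ≤-refl))
  where
  open Construction (seqSize (seqB ps i k))
  bound : extSize t[ ps , + suc k ] ≤ seqSize (seqB ps i k)
  bound = ≤-trans (≤-reflexive (cong suc (≡.trans (+-suc (length ps) k) (sym (+-identityʳ _)))))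
                  (≤-trans (m≤m+n _ 1) (≤-trans (m≤m+n _ _) (m≤m+n _ _)))
  instance
    bps : BoundedExt t[ ps , + suc k ]
    bps = boundedExt bound
    _ = BoundedExt-mono {xs = ps} {a = + k} ≤-refl (n≤1+n k) bps
    _ = BoundedExt-mono {xs = removeAt ps i} {a = + k} (length-removeAt≤ ps i) (n≤1+n k) bps

mainTheorem15 : Σ ℕ λ c → Σ ℕ λ d →
    ((ps : List PVar) (i : Fin (length ps)) (k : ℕ) →
      (Σ (List Seq) λ π → ProofOf 𝒯 (seqA ps i k) π × proofSize π ≤ c * seqSize (seqA ps i k) ^ d))
    × ((ps : List PVar) (i : Fin (length ps)) (k : ℕ) →
      (Σ (List Seq) λ π → ProofOf 𝒯 (seqB ps i k) π × proofSize π ≤ c * seqSize (seqB ps i k) ^ d))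
mainTheorem15 = 17255 , 3 , seqA-proof , seqB-proof
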